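{- Let $n,k,m$ be positive integers with $k\le m$. Then $\mu(n,k,m;k)=\frac{kn}{m}$ if and only if $n=c\cdot\frac{m}{\gcd{(m,k)}}$ for some integer $c\geq 0$.
   Context: An $(n,N,k,m;r)$ multiset combinatorial batch code (MCBC) is a collection $\mathcal C=\{C_1,\dots,C_m\}$ of subsets of $[n]=\{1,\dots,n\}$ (servers) with $N=\sum_{j=1}^m|C_j|$, such that for every multiset request $\{i_1,\dots,i_k\}$ of $k$ elements of $[n]$ in which every element has multiplicity at most $r$, there exist subsets $D_j\subseteq C_j$ with $|D_j|\le 1$ ($j\in[m]$) whose multiset union (the multiplicity of $i$ being $|\{j: i\in D_j\}|$) contains the request. An MCBC is regular if every server stores the same number $\mu=N/m$ of items, i.e. $|C_1|=\dots=|C_m|$. $\mu(n,k,m;r)$ denotes the smallest $\mu$ for which a regular $(n,m\mu,k,m;r)$-MCBC exists. -}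

module Defs where

open import Data.Nat using (ℕ; zero; suc; _+_; _*_; _≤_; _<_; NonZero; >-nonZero)
open import Data.Nat.DivMod using (_/_)
open import Data.Nat.GCD using (gcd; gcd[m,n]≢0)
open import Data.Nat.Properties using (m<n⇒n≢0)
open import Data.Nat.Base using (≢-nonZero)
open import Data.Fin using (Fin; _≟_)
open import Data.Fin.Subset using (Subset; _∈_; ∣_∣)
open import Data.Maybe using (Maybe; just; nothing)
open import Data.Vec using (tabulate; sum)
open import Data.Bool using (Bool; false)
open import Data.Product using (Σ; _×_)
open import Data.Sum using (inj₁)
open import Relation.Nullary using (¬_; does)
open import Relation.Binary.PropositionalEquality using (_≡_)

-- A code: m servers, server j stores the subset C j of [n] (items = Fin n).
Code : ℕ → ℕ → Set
Code n m = Fin m → Subset n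

-- A multiset request over [n]: multiplicity function.
Request : ℕ → Set
Request n = Fin n → ℕ

ValidRequest : (n k r : ℕ) → Request n → Set
ValidRequest n k r q = (sum (tabulate q) ≡ k) × (∀ i → q i ≤ r)

-- A retrieval: D_j ⊆ C_j with |D_j| ≤ 1, encoded as an optional item per server.
Retrieval : ℕ → ℕ → Set
Retrieval n m = Fin m → Maybe (Fin n)

hits : ∀ {n} → Maybe (Fin n) → Fin n → Bool
hits nothing  i = false
hits (just a) i = does (a ≟ i)

mult : ∀ {n m} → Retrieval n m → Fin n → ℕ
mult d i = ∣ tabulate (λ j → hits (d j) i) ∣

Serves : ∀ {n m} → Code n m → Retrieval n m → Request n → Set
Serves C d q = (∀ j i → d j ≡ just i → i ∈ C j) × (∀ i → q i ≤ mult d i)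

-- C is an (n, N, k, m; r) MCBC (N = Σ |C_j| is determined by C)
IsMCBC : (n k m r : ℕ) → Code n m → Set
IsMCBC n k m r C = ∀ q → ValidRequest n k r q → Σ (Retrieval n m) λ d → Serves C d q

Regular : ∀ {n m} → Code n m → ℕ → Set
Regular C μ = ∀ j → ∣ C j ∣ ≡ μ

RegularMCBCExists : (n k m r μ : ℕ) → Set
RegularMCBCExists n k m r μ = Σ (Code n m) λ C → IsMCBC n k m r C × Regular C μ

-- μ(n,k,m;r) = μ : μ is the smallest value admitting a regular MCBC
MuIs : (n k m r μ : ℕ) → Set
MuIs n k m r μ = RegularMCBCExists n k m r μ × (∀ μ' → μ' < μ → ¬ RegularMCBCExists n k m r μ')

m/gcd : (m k : ℕ) → 0 < m → ℕ
m/gcd m k 0<m = _/_ m (gcd m k) {{≢-nonZero (gcd[m,n]≢0 m k (inj₁ (m<n⇒n≢0 0<m)))}}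

module Submission where

-- Requesting k copies of a single item i forces i to be stored
-- on at least k servers, so by double counting a regular code stores
-- n·k ≤ m·μ items (storage-bound).  Hence a regular code with μ·m = k·n is
-- optimal (tight⇒optimal).
--
-- If every item has k designated servers which are pairwise
-- distinct, any request of size k is served greedily, one copy at a time: as
-- long as fewer than k servers are busy, the next copy still has a free
-- designated server (Greedy, distinct-servers⇒MCBC).  When μ·m = k·n the
-- round-robin layout, writing the n·k copies in order and sending position p
-- to server p mod m, has this property and puts μ distinct items on every
-- server (RoundRobin, round-robin-MCBC).
--
-- Arithmetic.  μ·m = k·n for some μ iff m/gcd(m,k) divides n, because m/g and
-- k/g are coprime (Balance).  The theorem combines these three parts.

open import Defs
open import Data.Bool using (Bool; true; false)
open import Data.Fin using (Fin; zero; suc; toℕ; fromℕ<)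
import Data.Fin as Fin
import Data.Fin.Properties as Fin
open import Data.Fin.Properties using (_≟_; any?; toℕ-fromℕ<; toℕ-injective; toℕ<n)
open import Data.Fin.Subset using (Subset; _∈_; ∣_∣)
open import Data.Maybe using (Maybe; just; nothing)
open import Data.Maybe.Properties using (≡-dec; just-injective)
open import Data.Nat using (ℕ; zero; suc; _+_; _*_; _∸_; _≤_; _<_; z≤n; s≤s; NonZero)
open import Data.Nat.Base using (≢-nonZero; >-nonZero)
open import Data.Nat.Coprimality using (coprime-divisor; coprime-/gcd)
open import Data.Nat.Divisibility using (_∣_; divides; *-cancelʳ-∣)
open import Data.Nat.DivMod
  using (_/_; _%_; m≡m%n+[m/n]*n; m%n<n; m<n*o⇒m/o<n; /-monoˡ-≤; m/n≡1+[m∸n]/n;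
         +-distrib-/-∣ˡ; m*n/n≡m; m<n⇒m/n≡0; m/n*n≡m)
open import Data.Nat.GCD using (gcd; gcd[m,n]≢0; gcd[m,n]∣m; gcd[m,n]∣n)
open import Data.Nat.Properties hiding (_≟_)
open import Data.Nat.Solver using (module +-*-Solver)
open import Data.Product using (Σ; _×_; _,_; ∃)
open import Data.Sum using (inj₁; inj₂)
open import Data.Vec using (tabulate; lookup)
import Data.Vec as Vec
open import Data.Vec.Functional using (updateAt)
open import Data.Vec.Functional.Properties using (updateAt-updates; updateAt-minimal)
open import Data.Vec.Properties using (lookup∘tabulate; tabulate∘lookup; lookup⇒[]=; []=⇒lookup)
open import Function.Bundles using (_⇔_; mk⇔)
open import Function.Definitions using (Injective)
open import Relation.Binary.Definitions using (tri<; tri≈; tri>)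
open import Relation.Binary.PropositionalEquality
open import Relation.Nullary using (¬_; does; yes; no; contradiction)
open import Algebra.Properties.Semiring.Sum +-*-semiring
  using (sum; sum-syntax; ∑-distrib-+; ∑-comm; sum-cong-≗)

⟦_⟧ : Bool → ℕ
⟦ true ⟧  = 1
⟦ false ⟧ = 0

⟦⟧-mono : ∀ {b c} → (b ≡ true → c ≡ true) → ⟦ b ⟧ ≤ ⟦ c ⟧
⟦⟧-mono {false} _   = z≤n
⟦⟧-mono {true}  b⇒c rewrite b⇒c refl = ≤-refl

δ : ∀ {n} → Fin n → Fin n → ℕ
δ a b = ⟦ does (a ≟ b) ⟧

δ-diag : ∀ {n} (a : Fin n) → δ a a ≡ 1
δ-diag a with a ≟ a
... | yes _  = refl
... | no a≢a = contradiction refl a≢a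

δ≤1 : ∀ {n} (a b : Fin n) → δ a b ≤ 1
δ≤1 a b with a ≟ b
... | yes _ = ≤-refl
... | no _  = z≤n

∑-const : ∀ n c → ∑[ i < n ] c ≡ n * c
∑-const zero    c = refl
∑-const (suc n) c = cong (c +_) (∑-const n c)

∑-zero : ∀ {n} {f : Fin n → ℕ} → (∀ i → f i ≡ 0) → sum f ≡ 0
∑-zero {n} f≡0 = trans (sum-cong-≗ f≡0) (trans (∑-const n 0) (*-zeroʳ n))

∑-mono : ∀ {n} {f g : Fin n → ℕ} → (∀ i → f i ≤ g i) → sum f ≤ sum g
∑-mono {zero}  f≤g = z≤n
∑-mono {suc n} f≤g = +-mono-≤ (f≤g zero) (∑-mono (λ i → f≤g (suc i)))

entry≤∑ : ∀ {n} (f : Fin n → ℕ) i → f i ≤ sum f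
entry≤∑ f zero    = m≤m+n (f zero) _
entry≤∑ f (suc i) = ≤-trans (entry≤∑ (λ j → f (suc j)) i) (m≤n+m _ (f zero))

∑-positive : ∀ {n} (f : Fin n → ℕ) → 0 < sum f → ∃ λ i → 0 < f i
∑-positive {suc n} f pos with f zero in eq
... | suc _ = zero , subst (0 <_) (sym eq) (s≤s z≤n)
... | zero  with ∑-positive (λ i → f (suc i)) pos
...   | i , fi>0 = suc i , fi>0

∑-single : ∀ {n} (f : Fin n → ℕ) (a : Fin n) → (∀ i → ¬ a ≡ i → f i ≡ 0) → sum f ≡ f a
∑-single f zero    off = trans (cong (f zero +_) (∑-zero (λ i → off (suc i) λ ()))) (+-identityʳ (f zero))
∑-single f (suc a) off =
  trans (cong (_+ ∑[ i < _ ] f (suc i)) (off zero λ ()))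
        (∑-single (λ i → f (suc i)) a (λ i a≢i → off (suc i) (λ eq → a≢i (Fin.suc-injective eq))))

∑-δ : ∀ {n} (a : Fin n) c → ∑[ i < n ] (δ a i * c) ≡ c
∑-δ a c = trans (∑-single (λ i → δ a i * c) a off) (trans (cong (_* c) (δ-diag a)) (+-identityʳ c))
  where
  off : ∀ i → ¬ a ≡ i → δ a i * c ≡ 0
  off i a≢i with a ≟ i
  ... | yes a≡i = contradiction a≡i a≢i
  ... | no _    = refl

∑δ≡1 : ∀ {n} (a : Fin n) → ∑[ i < n ] δ a i ≡ 1
∑δ≡1 a = trans (sum-cong-≗ (λ i → sym (*-identityʳ (δ a i)))) (∑-δ a 1)

sum-tabulate : ∀ {n} (f : Fin n → ℕ) → Vec.sum (tabulate f) ≡ sum f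
sum-tabulate {zero}  f = refl
sum-tabulate {suc n} f = cong (f zero +_) (sum-tabulate (λ i → f (suc i)))

∣tabulate∣ : ∀ {n} (b : Fin n → Bool) → ∣ tabulate b ∣ ≡ ∑[ i < n ] ⟦ b i ⟧
∣tabulate∣ {zero}  b = refl
∣tabulate∣ {suc n} b with b zero
... | true  = cong suc (∣tabulate∣ (λ i → b (suc i)))
... | false = ∣tabulate∣ (λ i → b (suc i))

∈-tabulate : ∀ {n} (b : Fin n → Bool) i → b i ≡ true → i ∈ tabulate b
∈-tabulate b i bi = lookup⇒[]= i (tabulate b) (trans (lookup∘tabulate b i) bi)

inImage : ∀ {p n} → (Fin p → Fin n) → Fin n → Bool
inImage g i = does (any? (λ t → g t ≟ i))

image : ∀ {p n} → (Fin p → Fin n) → Subset n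
image g = tabulate (inImage g)

inImage-self : ∀ {p n} (g : Fin p → Fin n) t → inImage g (g t) ≡ true
inImage-self g t with any? (λ t′ → g t′ ≟ g t)
... | yes _  = refl
... | no ¬gt = contradiction (t , refl) ¬gt

inImage-witness : ∀ {p n} (g : Fin p → Fin n) i → inImage g i ≡ true → ∃ λ t → g t ≡ i
inImage-witness g i _  with any? (λ t → g t ≟ i)
inImage-witness g i _  | yes gt≡i = gt≡i
inImage-witness g i () | no _

fibre-size : ∀ {p n} (g : Fin p → Fin n) → Injective _≡_ _≡_ g →
             ∀ i → ⟦ inImage g i ⟧ ≡ ∑[ t < p ] δ (g t) i
fibre-size g g-inj i with any? (λ t → g t ≟ i)
... | yes (t₀ , refl) = sym (trans (∑-single (λ t → δ (g t) (g t₀)) t₀ off) (δ-diag (g t₀)))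
  where
  off : ∀ t → ¬ t₀ ≡ t → δ (g t) (g t₀) ≡ 0
  off t t₀≢t with g t ≟ g t₀
  ... | yes gt≡gt₀ = contradiction (sym (g-inj gt≡gt₀)) t₀≢t
  ... | no _       = refl
... | no ¬∃ = sym (∑-zero off)
  where
  off : ∀ t → δ (g t) i ≡ 0
  off t with g t ≟ i
  ... | yes gt≡i = contradiction (t , gt≡i) ¬∃
  ... | no _     = refl

image-count : ∀ {p n} (g : Fin p → Fin n) → Injective _≡_ _≡_ g → ∑[ i < n ] ⟦ inImage g i ⟧ ≡ p
image-count {p} {n} g g-inj = begin
  ∑[ i < n ] ⟦ inImage g i ⟧         ≡⟨ sum-cong-≗ (fibre-size g g-inj) ⟩
  ∑[ i < n ] ∑[ t < p ] δ (g t) i    ≡⟨ ∑-comm (λ i t → δ (g t) i) ⟩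
  ∑[ t < p ] ∑[ i < n ] δ (g t) i    ≡⟨ sum-cong-≗ (λ t → ∑δ≡1 (g t)) ⟩
  ∑[ t < p ] 1                       ≡⟨ trans (∑-const p 1) (*-identityʳ p) ⟩
  p                                  ∎
  where open ≡-Reasoning

∣image∣ : ∀ {p n} (g : Fin p → Fin n) → Injective _≡_ _≡_ g → ∣ image g ∣ ≡ p
∣image∣ g g-inj = trans (∣tabulate∣ (inImage g)) (image-count g g-inj)

hits-just : ∀ {n} (x : Maybe (Fin n)) i → hits x i ≡ true → x ≡ just i
hits-just nothing  i ()
hits-just (just a) i h with a ≟ i
hits-just (just a) i _  | yes refl = refl
hits-just (just a) i () | no _

mult-∑ : ∀ {n m} (d : Retrieval n m) i → mult d i ≡ ∑[ j < m ] ⟦ hits (d j) i ⟧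
mult-∑ d i = ∣tabulate∣ (λ j → hits (d j) i)

-- Replication: if every request of k copies is served, each item lies on at
-- least k servers, since a server delivers at most one copy.
replication : ∀ {n k m} (C : Code n m) → IsMCBC n k m k C →
              ∀ i → k ≤ ∑[ j < m ] ⟦ lookup (C j) i ⟧
replication {n} {k} {m} C mcbc i with mcbc (λ i′ → δ i i′ * k) (single-valid)
  where
  single-valid : ValidRequest n k k (λ i′ → δ i i′ * k)
  single-valid = trans (sum-tabulate (λ i′ → δ i i′ * k)) (∑-δ i k) ,
                 λ i′ → ≤-trans (*-monoˡ-≤ k (δ≤1 i i′)) (≤-reflexive (+-identityʳ k))
... | d , stored , covered = begin
  k                                ≡⟨ sym (trans (cong (_* k) (δ-diag i)) (+-identityʳ k)) ⟩
  δ i i * k                        ≤⟨ covered i ⟩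
  mult d i                         ≡⟨ mult-∑ d i ⟩
  ∑[ j < m ] ⟦ hits (d j) i ⟧      ≤⟨ ∑-mono (λ j → ⟦⟧-mono (on-server j)) ⟩
  ∑[ j < m ] ⟦ lookup (C j) i ⟧    ∎
  where
  open ≤-Reasoning
  on-server : ∀ j → hits (d j) i ≡ true → lookup (C j) i ≡ true
  on-server j h = []=⇒lookup (stored j i (hits-just (d j) i h))

storage-bound : ∀ {n k m μ} (C : Code n m) → IsMCBC n k m k C → Regular C μ → n * k ≤ m * μ
storage-bound {n} {k} {m} {μ} C mcbc regular = begin
  n * k                                         ≡⟨ sym (∑-const n k) ⟩
  ∑[ i < n ] k                                  ≤⟨ ∑-mono (replication C mcbc) ⟩
  ∑[ i < n ] ∑[ j < m ] ⟦ lookup (C j) i ⟧      ≡⟨ ∑-comm (λ i j → ⟦ lookup (C j) i ⟧) ⟩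
  ∑[ j < m ] ∑[ i < n ] ⟦ lookup (C j) i ⟧      ≡⟨ sum-cong-≗ server-size ⟩
  ∑[ j < m ] μ                                  ≡⟨ ∑-const m μ ⟩
  m * μ                                         ∎
  where
  open ≤-Reasoning
  server-size : ∀ j → ∑[ i < n ] ⟦ lookup (C j) i ⟧ ≡ μ
  server-size j = begin-equality
    ∑[ i < n ] ⟦ lookup (C j) i ⟧  ≡⟨ ∣tabulate∣ (lookup (C j)) ⟨
    ∣ tabulate (lookup (C j)) ∣    ≡⟨ cong ∣_∣ (tabulate∘lookup (C j)) ⟩
    ∣ C j ∣                        ≡⟨ regular j ⟩
    μ                              ∎

remove-copy : ∀ {n} (q : Fin n → ℕ) i₀ → 0 < q i₀ →
              ∃ λ (q′ : Fin n → ℕ) → (∀ i → q i ≡ q′ i + δ i₀ i) × sum q ≡ suc (sum q′)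
remove-copy {n} q i₀ qi₀>0 = q′ , split , (begin
  sum q                                ≡⟨ sum-cong-≗ split ⟩
  ∑[ i < n ] (q′ i + δ i₀ i)           ≡⟨ ∑-distrib-+ q′ (δ i₀) ⟩
  sum q′ + ∑[ i < n ] δ i₀ i           ≡⟨ cong (sum q′ +_) (∑δ≡1 i₀) ⟩
  sum q′ + 1                           ≡⟨ +-comm (sum q′) 1 ⟩
  suc (sum q′)                         ∎)
  where
  open ≡-Reasoning
  q′ : Fin n → ℕ
  q′ i = q i ∸ δ i₀ i
  δ≤q : ∀ i → δ i₀ i ≤ q i
  δ≤q i with i₀ ≟ i
  ... | yes refl = qi₀>0
  ... | no _     = z≤n
  split : ∀ i → q i ≡ q′ i + δ i₀ i
  split i = sym (m∸n+n≡m (δ≤q i))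

∑-updateAt : ∀ {A : Set} {m} (F : A → ℕ) (xs : Fin m → A) j₀ x →
             ∑[ j < m ] F (updateAt xs j₀ (λ _ → x) j) + F (xs j₀) ≡ ∑[ j < m ] F (xs j) + F x
∑-updateAt {A} {m} F xs j₀ x = begin
  ∑[ j < m ] F (ys j) + F (xs j₀)                                ≡⟨ cong (sum (λ j → F (ys j)) +_) (∑-δ j₀ (F (xs j₀))) ⟨
  ∑[ j < m ] F (ys j) + ∑[ j < m ] (δ j₀ j * F (xs j₀))          ≡⟨ ∑-distrib-+ (λ j → F (ys j)) _ ⟨
  ∑[ j < m ] (F (ys j) + δ j₀ j * F (xs j₀))                     ≡⟨ sum-cong-≗ exchange ⟩
  ∑[ j < m ] (F (xs j) + δ j₀ j * F x)                           ≡⟨ ∑-distrib-+ (λ j → F (xs j)) _ ⟩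
  ∑[ j < m ] F (xs j) + ∑[ j < m ] (δ j₀ j * F x)                ≡⟨ cong (sum (λ j → F (xs j)) +_) (∑-δ j₀ (F x)) ⟩
  ∑[ j < m ] F (xs j) + F x                                      ∎
  where
  open ≡-Reasoning
  ys : Fin m → A
  ys = updateAt xs j₀ (λ _ → x)
  exchange : ∀ j → F (ys j) + δ j₀ j * F (xs j₀) ≡ F (xs j) + δ j₀ j * F x
  exchange j with j₀ ≟ j
  ... | yes refl = begin
    F (ys j₀) + 1 * F (xs j₀)   ≡⟨ cong₂ _+_ (cong F (updateAt-updates j₀ xs)) (*-identityˡ (F (xs j₀))) ⟩
    F x + F (xs j₀)             ≡⟨ +-comm (F x) (F (xs j₀)) ⟩
    F (xs j₀) + F x             ≡⟨ cong (F (xs j₀) +_) (*-identityˡ (F x)) ⟨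
    F (xs j₀) + 1 * F x         ∎
  ... | no j₀≢j  = cong (λ y → F y + 0) (updateAt-minimal j j₀ xs (λ j≡j₀ → j₀≢j (sym j≡j₀)))

occupied : ∀ {A : Set} → Maybe A → ℕ
occupied (just _) = 1
occupied nothing  = 0

load : ∀ {n m} → Retrieval n m → ℕ
load {m = m} d = ∑[ j < m ] occupied (d j)

occupied-≢nothing : ∀ {A : Set} (x : Maybe A) → ¬ x ≡ nothing → 1 ≤ occupied x
occupied-≢nothing (just _) _         = ≤-refl
occupied-≢nothing nothing  x≢nothing = contradiction refl x≢nothing

-- Greedy retrieval for a code in which item i may be fetched from the k
-- distinct servers h i 0, …, h i (k-1).
module Greedy {n m k : ℕ} (h : Fin n → Fin k → Fin m) (h-inj : ∀ i → Injective _≡_ _≡_ (h i)) where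

  Respects : Retrieval n m → Set
  Respects d = ∀ j i → d j ≡ just i → ∃ λ l → h i l ≡ j

  free-server : ∀ (d : Retrieval n m) i → load d < k → ∃ λ l → d (h i l) ≡ nothing
  free-server d i load<k with any? (λ l → ≡-dec _≟_ (d (h i l)) nothing)
  ... | yes free = free
  ... | no ¬free = contradiction saturated (<⇒≱ load<k)
    where
    busy : ∀ j → ⟦ inImage (h i) j ⟧ ≤ occupied (d j)
    busy j with inImage (h i) j in e
    ... | false = z≤n
    ... | true with inImage-witness (h i) j e
    ...   | l , refl = occupied-≢nothing (d (h i l)) (λ free → ¬free (l , free))
    saturated : k ≤ load d
    saturated = ≤-trans (≤-reflexive (sym (image-count (h i) (h-inj i)))) (∑-mono busy)

  add-copy : ∀ (d : Retrieval n m) i₀ → Respects d → load d < k →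
             Σ (Retrieval n m) λ d′ → Respects d′ × (∀ i → mult d′ i ≡ mult d i + δ i₀ i) × load d′ ≡ suc (load d)
  add-copy d i₀ respects load<k with free-server d i₀ load<k
  ... | l , free = d′ , respects′ , more , busier
    where
    j₀ : Fin m
    j₀ = h i₀ l
    d′ : Retrieval n m
    d′ = updateAt d j₀ (λ _ → just i₀)
    exchange : (F : Maybe (Fin n) → ℕ) → F nothing ≡ 0 →
               ∑[ j < m ] F (d′ j) ≡ ∑[ j < m ] F (d j) + F (just i₀)
    exchange F F-nothing = begin
      ∑[ j < m ] F (d′ j)                 ≡⟨ +-identityʳ _ ⟨
      ∑[ j < m ] F (d′ j) + 0             ≡⟨ cong (∑[ j < m ] F (d′ j) +_) (trans (cong F free) F-nothing) ⟨
      ∑[ j < m ] F (d′ j) + F (d j₀)      ≡⟨ ∑-updateAt F d j₀ (just i₀) ⟩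
      ∑[ j < m ] F (d j) + F (just i₀)    ∎
      where open ≡-Reasoning
    respects′ : Respects d′
    respects′ j i d′j≡i with j ≟ j₀
    ... | yes refl = l , cong (λ i′ → h i′ l) (just-injective (trans (sym d′j≡i) (updateAt-updates j₀ d)))
    ... | no j≢j₀  = respects j i (trans (sym (updateAt-minimal j j₀ d j≢j₀)) d′j≡i)
    more : ∀ i → mult d′ i ≡ mult d i + δ i₀ i
    more i = trans (mult-∑ d′ i) (trans (exchange (λ x → ⟦ hits x i ⟧) refl) (cong (_+ δ i₀ i) (sym (mult-∑ d i))))
    busier : load d′ ≡ suc (load d)
    busier = trans (exchange occupied refl) (+-comm (load d) 1)

  serve : ∀ t (q : Request n) → sum q ≡ t → t ≤ k →
          Σ (Retrieval n m) λ d → Respects d × (∀ i → q i ≤ mult d i) × load d ≤ t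
  serve zero q ∑q≡0 _ = idle , (λ _ _ ()) , nothing-needed , ≤-reflexive (∑-zero {m} (λ _ → refl))
    where
    idle : Retrieval n m
    idle _ = nothing
    nothing-needed : ∀ i → q i ≤ mult idle i
    nothing-needed i = ≤-trans (entry≤∑ q i) (≤-trans (≤-reflexive ∑q≡0) z≤n)
  serve (suc t) q ∑q≡1+t 1+t≤k with ∑-positive q (subst (0 <_) (sym ∑q≡1+t) (s≤s z≤n))
  ... | i₀ , qi₀>0 with remove-copy q i₀ qi₀>0
  ... | q′ , split , ∑q≡1+∑q′
    with serve t q′ (suc-injective (trans (sym ∑q≡1+∑q′) ∑q≡1+t)) (≤-trans (n≤1+n t) 1+t≤k)
  ... | d , respects , covered , load≤t with add-copy d i₀ respects (≤-<-trans load≤t 1+t≤k)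
  ... | d′ , respects′ , more , busier = d′ , respects′ , covered′ , ≤-trans (≤-reflexive busier) (s≤s load≤t)
    where
    covered′ : ∀ i → q i ≤ mult d′ i
    covered′ i = ≤-trans (≤-reflexive (split i)) (≤-trans (+-monoˡ-≤ (δ i₀ i) (covered i)) (≤-reflexive (sym (more i))))

distinct-servers⇒MCBC : ∀ {n k m r} (C : Code n m) (h : Fin n → Fin k → Fin m) →
                        (∀ i → Injective _≡_ _≡_ (h i)) → (∀ i l → i ∈ C (h i l)) → IsMCBC n k m r C
distinct-servers⇒MCBC {k = k} C h h-inj stored q (size , _)
  with Greedy.serve h h-inj k q (trans (sym (sum-tabulate q)) size) ≤-refl
... | d , respects , covered , _ = d , on-server , covered
  where
  on-server : ∀ j i → d j ≡ just i → i ∈ C j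
  on-server j i dj≡i with respects j i dj≡i
  ... | l , refl = stored i l

increasing⇒injective : ∀ {p} (f : Fin p → ℕ) → (∀ {x y : Fin p} → x Fin.< y → f x < f y) →
                       Injective _≡_ _≡_ f
increasing⇒injective f increasing {x} {y} fx≡fy with Fin.<-cmp x y
... | tri< x<y _ _ = contradiction fx≡fy (<⇒≢ (increasing x<y))
... | tri≈ _ x≡y _ = x≡y
... | tri> _ _ y<x = contradiction (sym fx≡fy) (<⇒≢ (increasing y<x))

%-gap : ∀ m .{{_ : NonZero m}} a b → a % m ≡ b % m → a / m < b / m → a + m ≤ b
%-gap m a b same-rem a/m<b/m = begin
  a + m                      ≡⟨ cong (_+ m) (m≡m%n+[m/n]*n a m) ⟩
  a % m + a / m * m + m      ≡⟨ +-assoc (a % m) (a / m * m) m ⟩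
  a % m + (a / m * m + m)    ≡⟨ cong (a % m +_) (+-comm (a / m * m) m) ⟩
  a % m + suc (a / m) * m    ≤⟨ +-mono-≤ (≤-reflexive same-rem) (*-monoˡ-≤ m a/m<b/m) ⟩
  b % m + b / m * m          ≡⟨ m≡m%n+[m/n]*n b m ⟨
  b                          ∎
  where open ≤-Reasoning

%-window-injective : ∀ m .{{_ : NonZero m}} {a b} → a % m ≡ b % m → a ≤ b → b < a + m → a ≡ b
%-window-injective m {a} {b} same-rem a≤b b<a+m with m≤n⇒m<n∨m≡n (/-monoˡ-≤ m a≤b)
... | inj₁ a/m<b/m = contradiction (%-gap m a b same-rem a/m<b/m) (<⇒≱ b<a+m)
... | inj₂ same-quot = begin
  a                    ≡⟨ m≡m%n+[m/n]*n a m ⟩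
  a % m + a / m * m    ≡⟨ cong₂ (λ r q → r + q * m) same-rem same-quot ⟩
  b % m + b / m * m    ≡⟨ m≡m%n+[m/n]*n b m ⟨
  b                    ∎
  where open ≡-Reasoning

/-gap : ∀ k .{{_ : NonZero k}} a b → a + k ≤ b → a / k < b / k
/-gap k a b a+k≤b = begin-strict
  a / k                  <⟨ n<1+n (a / k) ⟩
  suc (a / k)            ≡⟨ cong (λ x → suc (x / k)) (m+n∸n≡m a k) ⟨
  suc ((a + k ∸ k) / k)  ≡⟨ m/n≡1+[m∸n]/n (m≤n+m k a) ⟨
  (a + k) / k            ≤⟨ /-monoˡ-≤ k a+k≤b ⟩
  b / k                  ∎
  where open ≤-Reasoning

-- The n·k = μ·m copies of the items are written in
-- order, the k copies of item i at positions i·k, …, i·k + k - 1, and position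
-- p goes to server p mod m, where it occupies slot p / m.  Because k ≤ m the
-- copies of one item land on distinct servers, and each server receives μ
-- distinct items.
module RoundRobin (n k m μ : ℕ) .{{_ : NonZero k}} .{{_ : NonZero m}}
                  (k≤m : k ≤ m) (balanced : μ * m ≡ n * k) where

  position : Fin n → Fin k → ℕ
  position i l = toℕ i * k + toℕ l

  position<μm : ∀ i l → position i l < μ * m
  position<μm i l = begin-strict
    toℕ i * k + toℕ l    <⟨ +-monoʳ-< (toℕ i * k) (toℕ<n l) ⟩
    toℕ i * k + k        ≡⟨ +-comm (toℕ i * k) k ⟩
    suc (toℕ i) * k      ≤⟨ *-monoˡ-≤ k (toℕ<n i) ⟩
    n * k                ≡⟨ balanced ⟨
    μ * m                ∎
    where open ≤-Reasoning

  server : Fin n → Fin k → Fin m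
  server i l = fromℕ< (m%n<n (position i l) m)

  slot : Fin n → Fin k → Fin μ
  slot i l = fromℕ< (m<n*o⇒m/o<n (position<μm i l))

  -- The item in slot t of server s, which holds position s + t·m.
  content<nk : ∀ (s : Fin m) (t : Fin μ) → toℕ s + toℕ t * m < n * k
  content<nk s t = begin-strict
    toℕ s + toℕ t * m    <⟨ +-monoˡ-< (toℕ t * m) (toℕ<n s) ⟩
    suc (toℕ t) * m      ≤⟨ *-monoˡ-≤ m (toℕ<n t) ⟩
    μ * m                ≡⟨ balanced ⟩
    n * k                ∎
    where open ≤-Reasoning

  item : Fin m → Fin μ → Fin n
  item s t = fromℕ< (m<n*o⇒m/o<n (content<nk s t))

  code : Code n m
  code s = image (item s)

  -- The k copies of an item occupy a window of k ≤ m consecutive positions,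
  -- so their remainders modulo m differ.
  server-ordered-injective : ∀ i {x y} → toℕ x ≤ toℕ y → server i x ≡ server i y → x ≡ y
  server-ordered-injective i {x} {y} x≤y same-server =
    toℕ-injective (+-cancelˡ-≡ (toℕ i * k) (toℕ x) (toℕ y)
      (%-window-injective m same-rem (+-monoʳ-≤ (toℕ i * k) x≤y) in-window))
    where
    same-rem : position i x % m ≡ position i y % m
    same-rem = trans (sym (toℕ-fromℕ< _)) (trans (cong toℕ same-server) (toℕ-fromℕ< _))
    in-window : position i y < position i x + m
    in-window = begin-strict
      toℕ i * k + toℕ y          <⟨ +-monoʳ-< (toℕ i * k) (<-≤-trans (toℕ<n y) (≤-trans k≤m (m≤n+m m (toℕ x)))) ⟩
      toℕ i * k + (toℕ x + m)    ≡⟨ +-assoc (toℕ i * k) (toℕ x) m ⟨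
      position i x + m           ∎
      where open ≤-Reasoning

  server-injective : ∀ i → Injective _≡_ _≡_ (server i)
  server-injective i {l} {l′} same-server with ≤-total (toℕ l) (toℕ l′)
  ... | inj₁ l≤l′ = server-ordered-injective i l≤l′ same-server
  ... | inj₂ l′≤l = sym (server-ordered-injective i l′≤l (sym same-server))

  -- Consecutive slots of a server hold positions m ≥ k apart, hence different items.
  item-injective : ∀ s → Injective _≡_ _≡_ (item s)
  item-injective s same-item = increasing⇒injective (λ t → toℕ (item s t)) increasing (cong toℕ same-item)
    where
    increasing : ∀ {t t′ : Fin μ} → t Fin.< t′ → toℕ (item s t) < toℕ (item s t′)
    increasing {t} {t′} t<t′ = subst₂ _<_ (sym (toℕ-fromℕ< _)) (sym (toℕ-fromℕ< _))
      (/-gap k (toℕ s + toℕ t * m) (toℕ s + toℕ t′ * m) (begin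
        toℕ s + toℕ t * m + k      ≤⟨ +-monoʳ-≤ (toℕ s + toℕ t * m) k≤m ⟩
        toℕ s + toℕ t * m + m      ≡⟨ +-assoc (toℕ s) (toℕ t * m) m ⟩
        toℕ s + (toℕ t * m + m)    ≡⟨ cong (toℕ s +_) (+-comm (toℕ t * m) m) ⟩
        toℕ s + suc (toℕ t) * m    ≤⟨ +-monoʳ-≤ (toℕ s) (*-monoˡ-≤ m t<t′) ⟩
        toℕ s + toℕ t′ * m         ∎))
      where open ≤-Reasoning

  item-at-slot : ∀ i l → item (server i l) (slot i l) ≡ i
  item-at-slot i l = toℕ-injective (begin
    toℕ (item (server i l) (slot i l))                              ≡⟨ toℕ-fromℕ< _ ⟩
    (toℕ (server i l) + toℕ (slot i l) * m) / k                     ≡⟨ cong₂ (λ r q → (r + q * m) / k) (toℕ-fromℕ< (m%n<n (position i l) m)) (toℕ-fromℕ< (m<n*o⇒m/o<n (position<μm i l))) ⟩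
    (position i l % m + position i l / m * m) / k                   ≡⟨ cong (_/ k) (m≡m%n+[m/n]*n (position i l) m) ⟨
    (toℕ i * k + toℕ l) / k                                         ≡⟨ +-distrib-/-∣ˡ (toℕ l) (divides (toℕ i) refl) ⟩
    toℕ i * k / k + toℕ l / k                                       ≡⟨ cong₂ _+_ (m*n/n≡m (toℕ i) k) (m<n⇒m/n≡0 (toℕ<n l)) ⟩
    toℕ i + 0                                                       ≡⟨ +-identityʳ (toℕ i) ⟩
    toℕ i                                                           ∎)
    where open ≡-Reasoning

  stored : ∀ i l → i ∈ code (server i l)
  stored i l = subst (_∈ code (server i l)) (item-at-slot i l)
                 (∈-tabulate (inImage (item (server i l))) _ (inImage-self (item (server i l)) (slot i l)))

  regular : Regular code μ
  regular s = ∣image∣ (item s) (item-injective s)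

round-robin-MCBC : ∀ n k m μ .{{_ : NonZero k}} .{{_ : NonZero m}} →
                   k ≤ m → μ * m ≡ k * n → RegularMCBCExists n k m k μ
round-robin-MCBC n k m μ k≤m tight =
  code , distinct-servers⇒MCBC code server server-injective stored , regular
  where open RoundRobin n k m μ k≤m (trans tight (*-comm k n))

tight⇒optimal : ∀ {n k m μ} .{{_ : NonZero m}} →
                RegularMCBCExists n k m k μ → μ * m ≡ k * n → MuIs n k m k μ
tight⇒optimal {n} {k} {m} {μ} exists tight = exists , no-smaller
  where
  no-smaller : ∀ μ′ → μ′ < μ → ¬ RegularMCBCExists n k m k μ′
  no-smaller μ′ μ′<μ (C , mcbc , regular) = <⇒≱ (*-monoʳ-< m μ′<μ) (begin
    m * μ     ≡⟨ *-comm m μ ⟩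
    μ * m     ≡⟨ tight ⟩
    k * n     ≡⟨ *-comm k n ⟩
    n * k     ≤⟨ storage-bound C mcbc regular ⟩
    m * μ′    ∎)
    where open ≤-Reasoning

-- The balance condition μ·m = k·n in terms of g = gcd(m,k): it holds for some
-- μ exactly when n is a multiple of m/g, with μ = c·(k/g) when n = c·(m/g).
module Balance (m k : ℕ) (0<m : 0 < m) where

  instance
    gcd≢0 : NonZero (gcd m k)
    gcd≢0 = ≢-nonZero (gcd[m,n]≢0 m k (inj₁ (m<n⇒n≢0 0<m)))

  g m′ k′ : ℕ
  g  = gcd m k
  m′ = m / g
  k′ = k / g

  m′*g≡m : m′ * g ≡ m
  m′*g≡m = m/n*n≡m (gcd[m,n]∣m m k)

  k′*g≡k : k′ * g ≡ k
  k′*g≡k = m/n*n≡m (gcd[m,n]∣n m k)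

  -- μ·m = k·n makes m/g divide k/g · n, and m/g is coprime to k/g.
  balanced⇒divides : ∀ μ n → μ * m ≡ k * n → m/gcd m k 0<m ∣ n
  balanced⇒divides μ n tight = coprime-divisor (coprime-/gcd m k) (*-cancelʳ-∣ g m′g∣k′ng)
    where
    k′ng≡kn : k′ * n * g ≡ k * n
    k′ng≡kn = begin
      k′ * n * g      ≡⟨ *-assoc k′ n g ⟩
      k′ * (n * g)    ≡⟨ cong (k′ *_) (*-comm n g) ⟩
      k′ * (g * n)    ≡⟨ *-assoc k′ g n ⟨
      k′ * g * n      ≡⟨ cong (_* n) k′*g≡k ⟩
      k * n           ∎
      where open ≡-Reasoning
    m′g∣k′ng : m′ * g ∣ k′ * n * g
    m′g∣k′ng = subst₂ _∣_ (sym m′*g≡m) (sym k′ng≡kn) (divides μ (sym tight))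

  multiple⇒balanced : ∀ c n → n ≡ c * m/gcd m k 0<m → c * k′ * m ≡ k * n
  multiple⇒balanced c n n≡cm′ = begin
    c * k′ * m            ≡⟨ cong (c * k′ *_) m′*g≡m ⟨
    c * k′ * (m′ * g)     ≡⟨ solve 4 (λ c k′ m′ g → (c :* k′) :* (m′ :* g) := (k′ :* g) :* (c :* m′)) refl c k′ m′ g ⟩
    k′ * g * (c * m′)     ≡⟨ cong₂ _*_ k′*g≡k (sym n≡cm′) ⟩
    k * n                 ∎
    where
    open ≡-Reasoning
    open +-*-Solver

theorem4 : (n k m : ℕ) → 0 < n → 0 < k → (0<m : 0 < m) → k ≤ m →
    (Σ ℕ λ μ → MuIs n k m k μ × (μ * m ≡ k * n))
      ⇔ (Σ ℕ λ c → n ≡ c * m/gcd m k 0<m)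
theorem4 n k m _ 0<k 0<m k≤m = mk⇔ tight⇒multiple multiple⇒tight
  where
  open Balance m k 0<m using (k′; balanced⇒divides; multiple⇒balanced)
  instance
    k≢0 : NonZero k
    k≢0 = >-nonZero 0<k
    m≢0 : NonZero m
    m≢0 = >-nonZero 0<m

  tight⇒multiple : (Σ ℕ λ μ → MuIs n k m k μ × (μ * m ≡ k * n)) → Σ ℕ λ c → n ≡ c * m/gcd m k 0<m
  tight⇒multiple (μ , _ , tight) with balanced⇒divides μ n tight
  ... | divides c n≡cm′ = c , n≡cm′

  multiple⇒tight : (Σ ℕ λ c → n ≡ c * m/gcd m k 0<m) → Σ ℕ λ μ → MuIs n k m k μ × (μ * m ≡ k * n)
  multiple⇒tight (c , n≡cm′) = c * k′ , tight⇒optimal (round-robin-MCBC n k m (c * k′) k≤m tight) tight , tight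
    where
    tight : c * k′ * m ≡ k * n
    tight = multiple⇒balanced c n n≡cm′
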